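{- Let $G$ be a graph and let $v$ be a vertex of $G$ adjacent to two distinct vertices $l$ and $l'$ that both have degree one in $G$. Then $\mathrm{td}(G)=\mathrm{td}(G-\{l'\})$.
   Context: Graphs are finite and undirected. A treedepth decomposition of $G$ is a rooted forest $F$ with vertex set $V(G)$ such that every edge of $G$ joins a vertex to one of its ancestors in $F$; its depth is the maximum number of vertices on a root-to-node path of $F$. $\mathrm{td}(G)$ is the minimum depth of a treedepth decomposition of $G$. $G-X$ denotes deletion of the vertex set $X$. -}

module Defs where

open import Data.Nat using (ℕ; zero; suc; _≤_)
open import Data.Fin using (Fin; punchIn)
open import Data.Fin.Properties using (punchInᵢ≢i)
open import Data.Bool using (Bool; true; false)
open import Data.Maybe using (Maybe; just; nothing)
open import Data.List using (length; filterᵇ; allFin)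
open import Data.Product using (Σ; ∃; ∃-syntax; _×_; _,_)
open import Data.Sum using (_⊎_)
open import Relation.Binary.PropositionalEquality using (_≡_)

record Graph (n : ℕ) : Set where
  field
    adj   : Fin n → Fin n → Bool
    sym   : ∀ u v → adj u v ≡ adj v u
    loopless : ∀ v → adj v v ≡ false
open Graph public

degree : ∀ {n} → Graph n → Fin n → ℕ
degree {n} G v = length (filterᵇ (adj G v) (allFin n))

deleteVertex : ∀ {n} → Graph (suc n) → Fin (suc n) → Graph n
deleteVertex G x = record
  { adj = λ i j → adj G (punchIn x i) (punchIn x j)
  ; sym = λ i j → sym G (punchIn x i) (punchIn x j)
  ; loopless = λ i → loopless G (punchIn x i)
  }

-- A rooted forest on Fin n, given by a parent function (nothing = root).
-- iter p k v is the k-th ancestor of v (k = 0 gives v itself),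
-- or nothing if the path to the root has fewer than k+1 vertices.
iter : ∀ {n} → (Fin n → Maybe (Fin n)) → ℕ → Fin n → Maybe (Fin n)
iter p zero    v = just v
iter p (suc k) v with p v
... | nothing = nothing
... | just w  = iter p k w

Ancestor : ∀ {n} → (Fin n → Maybe (Fin n)) → Fin n → Fin n → Set
Ancestor p u v = ∃[ k ] (iter p (suc k) v ≡ just u)

-- p is a rooted forest of depth at most d: every root-to-node path has
-- at most d vertices, i.e. the d-th iterated ancestor never exists.
-- (This also forces acyclicity of the parent function.)
DepthAtMost : ∀ {n} → (Fin n → Maybe (Fin n)) → ℕ → Set
DepthAtMost {n} p d = ∀ (v : Fin n) → iter p d v ≡ nothing

IsTDDecomposition : ∀ {n} → Graph n → (Fin n → Maybe (Fin n)) → Set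
IsTDDecomposition {n} G p =
  ∀ (u v : Fin n) → adj G u v ≡ true → Ancestor p u v ⊎ Ancestor p v u

HasTDDOfDepth : ∀ {n} → Graph n → ℕ → Set
HasTDDOfDepth {n} G d =
  Σ (Fin n → Maybe (Fin n)) λ p → IsTDDecomposition G p × DepthAtMost p d

Treedepth : ∀ {n} → Graph n → ℕ → Set
Treedepth G t = HasTDDOfDepth G t × (∀ d → HasTDDOfDepth G d → t ≤ d)

-- Deleting a vertex x never increases treedepth: re-attach the children of x to the parent of x.
-- Conversely, take a decomposition of G − l′ of depth d. The edge lv makes l and v comparable.
-- If v lies above l, hang l′ below v: it then sits no deeper than l. If l lies above v, first
-- exchange the positions of l and v. Every neighbour of v other than l is comparable with v,
-- hence with its ancestor l, and the only neighbour of l is v, so the exchanged forest is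
-- still a decomposition of the same depth, now with v above l.
module Submission where

open import Defs hiding (sym)
open import Data.Nat using (ℕ; zero; suc; _+_)
open import Data.Nat.Properties using (≤-antisym; +-comm)
open import Data.Fin using (Fin; punchIn; punchOut; _≟_)
open import Data.Fin.Properties using (punchInᵢ≢i; punchIn-punchOut; punchOut-punchIn; punchIn-injective)
open import Data.Fin.Permutation.Components using (transpose; transpose-inverse)
open import Data.Bool using (true)
open import Data.Bool.Properties using (T-≡)
open import Data.Maybe using (Maybe; just; nothing)
open import Data.Maybe.Properties using (just-injective; map-injective)
open import Function.Definitions using (Injective)
import Data.Maybe as Maybe
open import Data.List using (List; []; _∷_; length; filterᵇ; allFin)
open import Data.List.Relation.Unary.Any using (here; there)
open import Data.List.Membership.Propositional using (_∈_)
open import Data.List.Membership.Propositional.Properties using (∈-allFin; ∈-filter⁺)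
open import Data.Product using (_,_)
open import Data.Sum using (_⊎_; inj₁; inj₂; [_,_]′)
import Data.Sum as Sum
open import Data.Empty using (⊥-elim)
open import Function using (_∘_; case_of_)
open import Function.Bundles using (Equivalence)
open import Relation.Nullary using (yes; no)
open import Relation.Nullary.Decidable using (T?; _⊎-dec_)
open import Relation.Binary.PropositionalEquality
  using (_≡_; _≢_; refl; sym; trans; cong; subst; subst₂; module ≡-Reasoning)

-- Adjacency of u and v is not part of the definition.
Pendant : ∀ {n} → Graph n → Fin n → Fin n → Set
Pendant G u v = ∀ w → adj G u w ≡ true → w ≡ v

edge-sym : ∀ {n} (G : Graph n) {a b} → adj G a b ≡ true → adj G b a ≡ true
edge-sym G {a} {b} ab = trans (Graph.sym G b a) ab

edge⇒≢ : ∀ {n} (G : Graph n) {a b} → adj G a b ≡ true → a ≢ b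
edge⇒≢ G {a} ab refl = case trans (sym ab) (loopless G a) of λ ()

∈-length≡1⇒≡ : ∀ {A : Set} {xs : List A} {a b} → length xs ≡ 1 → a ∈ xs → b ∈ xs → a ≡ b
∈-length≡1⇒≡ {xs = _ ∷ []} _ (here refl) (here refl) = refl
∈-length≡1⇒≡ {xs = _ ∷ _ ∷ _} ()

degree≡1⇒pendant : ∀ {n} (G : Graph n) {u v} → degree G u ≡ 1 → adj G u v ≡ true → Pendant G u v
degree≡1⇒pendant {n} G {u} deg uv w uw = ∈-length≡1⇒≡ deg (neighbour w uw) (neighbour _ uv)
  where
  neighbour : ∀ w → adj G u w ≡ true → w ∈ filterᵇ (adj G u) (allFin n)
  neighbour w uw = ∈-filter⁺ (T? ∘ adj G u) (∈-allFin w) (Equivalence.from T-≡ uw)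

Comparable : ∀ {n} → (Fin n → Maybe (Fin n)) → Fin n → Fin n → Set
Comparable p a b = Ancestor p a b ⊎ Ancestor p b a

module Forest {n} (p : Fin n → Maybe (Fin n)) where

  iter-parent : ∀ {y w} k → p y ≡ just w → iter p (suc k) y ≡ iter p k w
  iter-parent {y} k py with p y
  iter-parent k refl | just _ = refl

  iter-root : ∀ {y} k → p y ≡ nothing → iter p (suc k) y ≡ nothing
  iter-root {y} k py with p y
  iter-root k refl | nothing = refl

  iter-+ : ∀ m k {y w} → iter p m y ≡ just w → iter p (m + k) y ≡ iter p k w
  iter-+ zero    k refl = refl
  iter-+ (suc m) k {y} e with p y
  ... | just z = iter-+ m k e

  iter-+-nothing : ∀ m k {y} → iter p m y ≡ nothing → iter p (m + k) y ≡ nothing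
  iter-+-nothing (suc m) k {y} e with p y
  ... | nothing = refl
  ... | just z  = iter-+-nothing m k e

  ancestor-parent : ∀ {y w} → p y ≡ just w → Ancestor p w y
  ancestor-parent py = zero , iter-parent zero py

  ancestor-trans : ∀ {a b c} → Ancestor p a b → Ancestor p b c → Ancestor p a c
  ancestor-trans (i , ba) (j , cb) = j + suc i , trans (iter-+ (suc j) (suc i) cb) ba

  ancestor-parent-trans : ∀ {u y w} → p y ≡ just w → Ancestor p u w → Ancestor p u y
  ancestor-parent-trans py uw = ancestor-trans uw (ancestor-parent py)

  ancestor-depth : ∀ {a b} k → Ancestor p a b → iter p (suc k) b ≡ nothing → iter p k a ≡ nothing
  ancestor-depth {a} {b} k (j , ba) b-shallow = begin
    iter p k a             ≡⟨ iter-+ (suc j) k ba ⟨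
    iter p (suc j + k) b   ≡⟨ cong (λ m → iter p (suc m) b) (+-comm j k) ⟩
    iter p (suc k + j) b   ≡⟨ iter-+-nothing (suc k) j b-shallow ⟩
    nothing                ∎
    where open ≡-Reasoning

  iter-comparable : ∀ i j {y a b} → iter p i y ≡ just a → iter p j y ≡ just b → a ≢ b →
                    Comparable p a b
  iter-comparable zero    zero    refl refl a≢b = ⊥-elim (a≢b refl)
  iter-comparable zero    (suc j) refl ya   _   = inj₂ (j , ya)
  iter-comparable (suc i) zero    yb   refl _   = inj₁ (i , yb)
  iter-comparable (suc i) (suc j) {y} ya yb a≢b with p y
  ... | just w = iter-comparable i j ya yb a≢b

  ancestors-comparable : ∀ {y a b} → Ancestor p a y → Ancestor p b y → a ≢ b → Comparable p a b
  ancestors-comparable (i , ya) (j , yb) = iter-comparable (suc i) (suc j) ya yb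

  comparable-through-ancestor : ∀ {l v w} → Ancestor p l v → l ≢ w →
                                Comparable p v w → Comparable p l w
  comparable-through-ancestor l-above-v l≢w =
    [ (λ v-above-w → inj₁ (ancestor-trans l-above-v v-above-w))
    , (λ w-above-v → ancestors-comparable l-above-v w-above-v l≢w) ]′

  iter-suc : ∀ k y → iter p (suc k) y ≡ Maybe.maybe (iter p k) nothing (p y)
  iter-suc k y with p y
  ... | nothing = refl
  ... | just _  = refl

  iter-sameParent : ∀ k {a b} → p a ≡ p b → iter p (suc k) a ≡ iter p (suc k) b
  iter-sameParent k {a} {b} pa≡pb =
    trans (iter-suc k a) (trans (cong (Maybe.maybe (iter p k) nothing) pa≡pb) (sym (iter-suc k b)))

  ancestor-sameParent : ∀ {u a b} → p a ≡ p b → Ancestor p u b → Ancestor p u a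
  ancestor-sameParent pa≡pb (k , bu) = k , trans (iter-sameParent k pa≡pb) bu

  depthAtMost⇒parent≢self : ∀ d {x} → DepthAtMost p d → p x ≢ just x
  depthAtMost⇒parent≢self d {x} D px = case trans (sym (loop d)) (D x) of λ ()
    where
    loop : ∀ k → iter p k x ≡ just x
    loop zero    = refl
    loop (suc k) = trans (iter-parent k px) (loop k)

module Relabel {m n} (f : Fin m → Fin n) (p : Fin m → Maybe (Fin m)) (q : Fin n → Maybe (Fin n))
               (q∘f : ∀ y → q (f y) ≡ Maybe.map f (p y)) where

  iter-relabel : ∀ k y → iter q k (f y) ≡ Maybe.map f (iter p k y)
  iter-relabel zero    y = refl
  iter-relabel (suc k) y with p y in py
  ... | nothing = Forest.iter-root q k (trans (q∘f y) (cong (Maybe.map f) py))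
  ... | just w  = trans (Forest.iter-parent q k (trans (q∘f y) (cong (Maybe.map f) py))) (iter-relabel k w)

  depth-relabel : ∀ k y → iter p k y ≡ nothing → iter q k (f y) ≡ nothing
  depth-relabel k y e = trans (iter-relabel k y) (cong (Maybe.map f) e)

  ancestor-relabel : ∀ {a b} → Ancestor p a b → Ancestor q (f a) (f b)
  ancestor-relabel {b = b} (k , ba) = k , trans (iter-relabel (suc k) b) (cong (Maybe.map f) ba)

  comparable-relabel : ∀ {a b} → Comparable p a b → Comparable q (f a) (f b)
  comparable-relabel = Sum.map ancestor-relabel ancestor-relabel

  module _ (f-injective : Injective _≡_ _≡_ f) where

    depth-unrelabel : ∀ k y → iter q k (f y) ≡ nothing → iter p k y ≡ nothing
    depth-unrelabel k y e = map-injective f-injective (trans (sym (iter-relabel k y)) e)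

    ancestor-unrelabel : ∀ {a b} → Ancestor q (f a) (f b) → Ancestor p a b
    ancestor-unrelabel {b = b} (k , ba) =
      k , map-injective f-injective (trans (sym (iter-relabel (suc k) b)) ba)

    comparable-unrelabel : ∀ {a b} → Comparable q (f a) (f b) → Comparable p a b
    comparable-unrelabel = Sum.map ancestor-unrelabel ancestor-unrelabel

module Bypass {n} (p : Fin n → Maybe (Fin n)) (x : Fin n) (px≢x : p x ≢ just x) where
  open Forest p

  bypass : Maybe (Fin n) → Maybe (Fin n)
  bypass nothing  = nothing
  bypass (just w) with w ≟ x
  ... | yes _ = p x
  ... | no  _ = just w

  -- The value at x itself is irrelevant: x is deleted afterwards.
  bypassed : Fin n → Maybe (Fin n)
  bypassed y = bypass (p y)

  bypass-≢x : ∀ m → bypass m ≢ just x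
  bypass-≢x (just w) e with w ≟ x
  ... | yes _   = px≢x e
  ... | no  w≢x = w≢x (just-injective e)

  bypass-x : bypass (just x) ≡ p x
  bypass-x with x ≟ x
  ... | yes _   = refl
  ... | no  x≢x = ⊥-elim (x≢x refl)

  bypass-≢ : ∀ {w} → w ≢ x → bypass (just w) ≡ just w
  bypass-≢ {w} w≢x with w ≟ x
  ... | yes w≡x = ⊥-elim (w≢x w≡x)
  ... | no  _   = refl

  bypass-id : ∀ {m} → m ≢ just x → bypass m ≡ m
  bypass-id {nothing} _   = refl
  bypass-id {just w}  m≢x = bypass-≢ (m≢x ∘ cong just)

  bypass-ancestor : ∀ {y z} m → p y ≡ m → bypass m ≡ just z → Ancestor p z y
  bypass-ancestor {y} (just w) py e with w ≟ x
  ... | yes refl = ancestor-parent-trans py (ancestor-parent e)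
  ... | no  _    = subst (λ u → Ancestor p u y) (just-injective e) (ancestor-parent py)

  bypassed-ancestor : ∀ {y z} → bypassed y ≡ just z → Ancestor p z y
  bypassed-ancestor {y} = bypass-ancestor (p y) refl

  bypassed-depth : ∀ k y → iter p k y ≡ nothing → iter bypassed k y ≡ nothing
  bypassed-depth (suc k) y shallow with bypassed y in e
  ... | nothing = refl
  ... | just z  = bypassed-depth k z (ancestor-depth k (bypassed-ancestor e) shallow)

  bypassed-parent : ∀ {a w} → p a ≡ just w → w ≢ x → bypassed a ≡ just w
  bypassed-parent pa w≢x = trans (cong bypass pa) (bypass-≢ w≢x)

  bypass-ancestor-preserved : ∀ k {a b} m → p a ≡ m → b ≢ x → iter p (suc k) a ≡ just b →
                              Ancestor bypassed b a
  bypass-ancestor-preserved k nothing pa _ ab = case trans (sym (iter-root k pa)) ab of λ ()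
  bypass-ancestor-preserved zero {a} {b} (just w) pa b≢x ab =
    subst (λ u → Ancestor bypassed u a) w≡b
          (Forest.ancestor-parent bypassed (bypassed-parent pa (b≢x ∘ trans (sym w≡b))))
    where
    w≡b : w ≡ b
    w≡b = just-injective (trans (sym (iter-parent zero pa)) ab)
  bypass-ancestor-preserved (suc k) {a} {b} (just w) pa b≢x ab with w ≟ x
  ... | no w≢x   = Forest.ancestor-parent-trans bypassed (bypassed-parent pa w≢x)
                     (bypass-ancestor-preserved k (p w) refl b≢x wb)
    where
    wb : iter p (suc k) w ≡ just b
    wb = trans (sym (iter-parent (suc k) pa)) ab
  ... | yes refl = Forest.ancestor-sameParent bypassed sameParent
                     (bypass-ancestor-preserved k (p x) refl b≢x xb)
    where
    xb : iter p (suc k) x ≡ just b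
    xb = trans (sym (iter-parent (suc k) pa)) ab
    sameParent : bypassed a ≡ bypassed x
    sameParent = trans (cong bypass pa) (trans bypass-x (sym (bypass-id px≢x)))

  bypassed-ancestor-preserved : ∀ {a b} → b ≢ x → Ancestor p b a → Ancestor bypassed b a
  bypassed-ancestor-preserved {a} b≢x (k , ab) = bypass-ancestor-preserved k (p a) refl b≢x ab

  bypassed-comparable : ∀ {a b} → a ≢ x → b ≢ x → Comparable p a b → Comparable bypassed a b
  bypassed-comparable a≢x b≢x =
    Sum.map (bypassed-ancestor-preserved a≢x) (bypassed-ancestor-preserved b≢x)

data PunchInView {n} (x : Fin (suc n)) : Fin (suc n) → Set where
  deleted : PunchInView x x
  kept    : ∀ y → PunchInView x (punchIn x y)

punchInView : ∀ {n} (x z : Fin (suc n)) → PunchInView x z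
punchInView x z with x ≟ z
... | yes refl = deleted
... | no  x≢z  = subst (PunchInView x) (punchIn-punchOut x≢z) (kept (punchOut x≢z))

punchOutMaybe : ∀ {n} (x : Fin (suc n)) → Maybe (Fin (suc n)) → Maybe (Fin n)
punchOutMaybe x nothing = nothing
punchOutMaybe x (just z) with punchInView x z
... | deleted = nothing
... | kept y  = just y

punchIn-punchOutMaybe : ∀ {n} (x : Fin (suc n)) {m} → m ≢ just x →
                        Maybe.map (punchIn x) (punchOutMaybe x m) ≡ m
punchIn-punchOutMaybe x {nothing} _ = refl
punchIn-punchOutMaybe x {just z} m≢x with punchInView x z
... | deleted = ⊥-elim (m≢x refl)
... | kept y  = refl

deleteVertex-hasTDD : ∀ {n} (G : Graph (suc n)) x d →
                      HasTDDOfDepth G d → HasTDDOfDepth (deleteVertex G x) d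
deleteVertex-hasTDD {n} G x d (p , p-td , p-depth) = q , q-td , q-depth
  where
  open Bypass p x (Forest.depthAtMost⇒parent≢self p d p-depth)
  q : Fin n → Maybe (Fin n)
  q y = punchOutMaybe x (bypassed (punchIn x y))
  open Relabel (punchIn x) q bypassed
               (λ y → sym (punchIn-punchOutMaybe x (bypass-≢x (p (punchIn x y)))))
  q-depth : DepthAtMost q d
  q-depth y =
    depth-unrelabel (punchIn-injective x _ _) d y (bypassed-depth d (punchIn x y) (p-depth _))
  q-td : IsTDDecomposition (deleteVertex G x) q
  q-td a b ab = comparable-unrelabel (punchIn-injective x _ _)
                  (bypassed-comparable (punchInᵢ≢i x a) (punchInᵢ≢i x b) (p-td _ _ ab))

module AttachLeaf {n} (x : Fin (suc n)) (v : Fin n) (p : Fin n → Maybe (Fin n)) where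

  extended : Fin (suc n) → Maybe (Fin (suc n))
  extended z with x ≟ z
  ... | yes _   = just (punchIn x v)
  ... | no  x≢z = Maybe.map (punchIn x) (p (punchOut x≢z))

  extended-x : extended x ≡ just (punchIn x v)
  extended-x with x ≟ x
  ... | yes _   = refl
  ... | no  x≢x = ⊥-elim (x≢x refl)

  extended-punchIn : ∀ y → extended (punchIn x y) ≡ Maybe.map (punchIn x) (p y)
  extended-punchIn y with x ≟ punchIn x y
  ... | yes x≡y = ⊥-elim (punchInᵢ≢i x y (sym x≡y))
  ... | no  x≢y = cong (Maybe.map (punchIn x) ∘ p) (punchOut-punchIn x)

  open Relabel (punchIn x) p extended extended-punchIn

  extended-depth : ∀ d {y} → DepthAtMost p d → Ancestor p v y → DepthAtMost extended d
  extended-depth d       p-depth _ z with punchInView x z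
  ... | kept z′ = depth-relabel d z′ (p-depth z′)
  extended-depth zero    {y} p-depth _ z | deleted = case p-depth y of λ ()
  extended-depth (suc k) {y} p-depth v-above-y z | deleted =
    trans (Forest.iter-parent extended k extended-x)
          (depth-relabel k v (Forest.ancestor-depth p k v-above-y (p-depth y)))

  attachLeaf-hasTDD : ∀ (G : Graph (suc n)) d {y} → Pendant G x (punchIn x v) →
                      IsTDDecomposition (deleteVertex G x) p → DepthAtMost p d → Ancestor p v y →
                      HasTDDOfDepth G d
  attachLeaf-hasTDD G d x-pendant p-td p-depth v-above-y =
    extended , td , extended-depth d p-depth v-above-y
    where
    leaf-comparable : ∀ b → adj G x b ≡ true → Comparable extended x b
    leaf-comparable b xb = inj₂ (subst (λ u → Ancestor extended u x) (sym (x-pendant b xb))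
                                       (Forest.ancestor-parent extended extended-x))
    td : IsTDDecomposition G extended
    td a b ab with punchInView x a | punchInView x b
    ... | deleted | _       = leaf-comparable b ab
    ... | kept a′ | deleted = Sum.swap (leaf-comparable a (edge-sym G ab))
    ... | kept a′ | kept b′ = comparable-relabel (p-td a′ b′ ab)

transpose-matchˡ : ∀ {n} (i j : Fin n) → transpose i j i ≡ j
transpose-matchˡ i j with i ≟ i
... | yes _   = refl
... | no  i≢i = ⊥-elim (i≢i refl)

transpose-matchʳ : ∀ {n} (i j : Fin n) → transpose i j j ≡ i
transpose-matchʳ i j with j ≟ i
... | yes j≡i = j≡i
... | no  _ with j ≟ j
...   | yes _   = refl
...   | no  j≢j = ⊥-elim (j≢j refl)

transpose-other : ∀ {n} {i j k : Fin n} → k ≢ i → k ≢ j → transpose i j k ≡ k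
transpose-other {i = i} {j} {k} k≢i k≢j with k ≟ i
... | yes k≡i = ⊥-elim (k≢i k≡i)
... | no  _ with k ≟ j
...   | yes k≡j = ⊥-elim (k≢j k≡j)
...   | no  _   = refl

module SwapPendant {n} (p : Fin n → Maybe (Fin n)) (l v : Fin n) where

  swapped : Fin n → Maybe (Fin n)
  swapped y = Maybe.map (transpose l v) (p (transpose v l y))

  open Relabel (transpose l v) p swapped
               (λ y → cong (Maybe.map (transpose l v) ∘ p) (transpose-inverse v l))

  swapped-depth : ∀ d → DepthAtMost p d → DepthAtMost swapped d
  swapped-depth d p-depth z =
    subst (λ u → iter swapped d u ≡ nothing) (transpose-inverse l v)
          (depth-relabel d (transpose v l z) (p-depth _))

  swapped-comparable : ∀ {a b} → Comparable p (transpose v l a) (transpose v l b) →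
                       Comparable swapped a b
  swapped-comparable =
    subst₂ (Comparable swapped) (transpose-inverse l v) (transpose-inverse l v) ∘ comparable-relabel

  module _ (K : Graph n) (l-pendant : Pendant K l v) (p-td : IsTDDecomposition K p)
           (l-above-v : Ancestor p l v) where

    pendant-swap-comparable : ∀ a b → adj K a b ≡ true → a ≡ l ⊎ a ≡ v →
                              Comparable p (transpose v l a) (transpose v l b)
    pendant-swap-comparable a b ab (inj₁ refl)
      rewrite l-pendant b ab | transpose-matchʳ v l | transpose-matchˡ v l = inj₂ l-above-v
    pendant-swap-comparable a b ab (inj₂ refl) with b ≟ l
    ... | yes refl rewrite transpose-matchʳ v l | transpose-matchˡ v l = inj₁ l-above-v
    ... | no  b≢l rewrite transpose-matchˡ v l | transpose-other (edge⇒≢ K (edge-sym K ab)) b≢l =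
      Forest.comparable-through-ancestor p l-above-v (b≢l ∘ sym) (p-td v b ab)

    swapped-td : IsTDDecomposition K swapped
    swapped-td a b ab with (a ≟ l) ⊎-dec (a ≟ v) | (b ≟ l) ⊎-dec (b ≟ v)
    ... | yes a-end | _        = swapped-comparable (pendant-swap-comparable a b ab a-end)
    ... | no  _     | yes b-end =
      swapped-comparable (Sum.swap (pendant-swap-comparable b a (edge-sym K ab) b-end))
    ... | no  a-mid | no b-mid = swapped-comparable (subst₂ (Comparable p)
      (sym (transpose-other (a-mid ∘ inj₂) (a-mid ∘ inj₁)))
      (sym (transpose-other (b-mid ∘ inj₂) (b-mid ∘ inj₁)))
      (p-td a b ab))

    swapped-above : Ancestor swapped v l
    swapped-above =
      subst₂ (Ancestor swapped) (transpose-matchˡ l v) (transpose-matchʳ l v) (ancestor-relabel l-above-v)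

pendant-deleteVertex : ∀ {n} (G : Graph (suc n)) {x a b} →
                       Pendant G (punchIn x a) (punchIn x b) → Pendant (deleteVertex G x) a b
pendant-deleteVertex G {x} x-pendant w aw = punchIn-injective x _ _ (x-pendant (punchIn x w) aw)

deleteTwinLeaf-hasTDD⁻ : ∀ {n} (G : Graph (suc n)) {v l l′} → l ≢ l′ →
                          adj G l v ≡ true → adj G l′ v ≡ true → Pendant G l v → Pendant G l′ v →
                          ∀ d → HasTDDOfDepth (deleteVertex G l′) d → HasTDDOfDepth G d
deleteTwinLeaf-hasTDD⁻ G {v} {l} {l′} l≢l′ lv l′v l-pendant l′-pendant d (p , p-td , p-depth)
  with punchInView l′ v | punchInView l′ l
... | deleted | _       = ⊥-elim (edge⇒≢ G l′v refl)
... | kept _  | deleted = ⊥-elim (l≢l′ refl)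
... | kept v₀ | kept l₀ with p-td l₀ v₀ lv
...   | inj₂ v-above-l = attachLeaf-hasTDD G d l′-pendant p-td p-depth v-above-l
  where open AttachLeaf l′ v₀ p
...   | inj₁ l-above-v = attachLeaf-hasTDD G d {l₀} l′-pendant (swapped-td H l₀-pendant p-td l-above-v)
                           (swapped-depth d p-depth) (swapped-above H l₀-pendant p-td l-above-v)
  where
  H : Graph _
  H = deleteVertex G l′
  l₀-pendant : Pendant H l₀ v₀
  l₀-pendant = pendant-deleteVertex G l-pendant
  open SwapPendant p l₀ v₀
  open AttachLeaf l′ v₀ swapped

mainTheorem6 : ∀ {n} (G : Graph (suc n)) (v l l′ : Fin (suc n)) →
    l ≢ l′ →
    adj G v l ≡ true → adj G v l′ ≡ true →
    degree G l ≡ 1 → degree G l′ ≡ 1 →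
    ∀ (t t′ : ℕ) → Treedepth G t → Treedepth (deleteVertex G l′) t′ → t ≡ t′
mainTheorem6 G v l l′ l≢l′ vl vl′ deg-l deg-l′ t t′ (td-t , t-minimal) (td-t′ , t′-minimal) =
  ≤-antisym (t-minimal t′ (deleteTwinLeaf-hasTDD⁻ G l≢l′ lv l′v l-pendant l′-pendant t′ td-t′))
            (t′-minimal t (deleteVertex-hasTDD G l′ t td-t))
  where
  lv : adj G l v ≡ true
  lv = edge-sym G vl
  l′v : adj G l′ v ≡ true
  l′v = edge-sym G vl′
  l-pendant : Pendant G l v
  l-pendant = degree≡1⇒pendant G deg-l lv
  l′-pendant : Pendant G l′ v
  l′-pendant = degree≡1⇒pendant G deg-l′ l′v
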